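{- For each even $k\in\mathbb{N}$ we have $|\mathcal{M}_k|\ge 2^{|\mathcal{P}_k|}$.
   Context: $\mathcal{M}_k$ is the set of all $k$-uniform MLCIFs on $[2k]$: families $\mathcal{F}\subseteq\binom{[2k]}{k}$ that are intersecting, left-compressed (if $F\in\mathcal{F}$ and $F'=\{y_1<\dots<y_k\}$, $F=\{x_1<\dots<x_k\}$ with $y_i\le x_i$ for all $i$, then $F'\in\mathcal{F}$), and maximal under inclusion among left-compressed intersecting families. For $F\in\binom{[2k]}{k}$ let $F^c:=[2k]\setminus F$ and $\Sigma(F):=\sum_{x\in F}x$. For even $k$, $\mathcal{P}_k:=\{\{F,F^c\}: F\in\binom{[2k]}{k},\ \Sigma(F)=\Sigma(F^c)=\tfrac{k}{2}(2k+1)\}$. -}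

module Defs where

open import Data.Nat using (ℕ; zero; suc; _+_; _*_; _≤_; _≤?_; _/_)
open import Data.Nat.Properties using (_≟_)
open import Data.Bool using (true; false)
import Data.Bool as Bool
open import Data.Fin using (Fin; toℕ)
import Data.Fin as Fin
open import Data.Fin.Subset
  using (Subset; inside; outside; _∈_; _⊆_; _∩_; _∪_; ∁; ⁅_⁆; Nonempty; ∣_∣)
open import Data.Fin.Subset.Properties using (_∈?_; _⊆?_; nonempty?; anySubset?)
open import Data.Fin.Properties using (all?)
open import Data.List using (List; []; _∷_; map; length; filter; lookup; _++_)
open import Data.Nat.ListAction using (sum)
open import Data.List.Relation.Binary.Pointwise using (Pointwise)
open import Data.List.Relation.Binary.Pointwise.Properties using (decidable)
open import Data.Vec using ([]; _∷_)
open import Data.Vec.Properties using (≡-dec)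
open import Data.Product using (Σ; _×_; _,_; ∃; ∃-syntax)
open import Relation.Nullary using (Dec; yes; no; ¬_)
open import Relation.Nullary.Decidable using (_×-dec_; _→-dec_; ¬?)
open import Relation.Binary.PropositionalEquality using (_≡_)

allSubsets : (n : ℕ) → List (Subset n)
allSubsets zero = [] ∷ []
allSubsets (suc n) = map (inside ∷_) (allSubsets n) ++ map (outside ∷_) (allSubsets n)

elems : {n : ℕ} → Subset n → List (Fin n)
elems [] = []
elems (inside ∷ p) = Fin.zero ∷ map Fin.suc (elems p)
elems (outside ∷ p) = map Fin.suc (elems p)

-- Ground set [2k] = {1,…,2k} is modelled by Fin (2 * k); Fin index x stands for x+1.
-- Σ(F) = sum of the elements of F, as elements of {1,…,2k}.
ΣF : {n : ℕ} → Subset n → ℕ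
ΣF F = sum (map (λ x → suc (toℕ x)) (elems F))

KSets : (k : ℕ) → List (Subset (2 * k))
KSets k = filter (λ A → ∣ A ∣ ≟ k) (allSubsets (2 * k))

-- A family 𝓕 ⊆ binom([2k],k) is a subset of the index set of KSets k.
Family : ℕ → Set
Family k = Subset (length (KSets k))

set : (k : ℕ) → Fin (length (KSets k)) → Subset (2 * k)
set k i = lookup (KSets k) i

Intersecting : (k : ℕ) → Family k → Set
Intersecting k 𝓕 = ∀ i j → i ∈ 𝓕 → j ∈ 𝓕 → Nonempty (set k i ∩ set k j)

_≼_ : {n : ℕ} → Subset n → Subset n → Set
F' ≼ F = Pointwise (λ y x → toℕ y ≤ toℕ x) (elems F') (elems F)

LeftCompressed : (k : ℕ) → Family k → Set
LeftCompressed k 𝓕 = ∀ i j → i ∈ 𝓕 → set k j ≼ set k i → j ∈ 𝓕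

LCI : (k : ℕ) → Family k → Set
LCI k 𝓕 = Intersecting k 𝓕 × LeftCompressed k 𝓕

IsMLCIF : (k : ℕ) → Family k → Set
IsMLCIF k 𝓕 = LCI k 𝓕 × (∀ 𝓖 → LCI k 𝓖 → 𝓕 ⊆ 𝓖 → 𝓖 ≡ 𝓕)

IsPk : (k : ℕ) → Family k → Set
IsPk k 𝓐 = ∃[ i ] ∃[ j ] (set k j ≡ ∁ (set k i)
                           × ΣF (set k i) ≡ (k * (2 * k + 1)) / 2
                           × ΣF (set k j) ≡ (k * (2 * k + 1)) / 2
                           × 𝓐 ≡ ⁅ i ⁆ ∪ ⁅ j ⁆)

private
  _≟S_ : {n : ℕ} → (p q : Subset n) → Dec (p ≡ q)
  _≟S_ = ≡-dec Bool._≟_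

  allSubset? : {n : ℕ} {P : Subset n → Set} → ((p : Subset n) → Dec (P p)) → Dec (∀ p → P p)
  allSubset? {P = P} P? with anySubset? (λ p → ¬? (P? p))
  ... | yes (p , ¬Pp) = no (λ ∀P → ¬Pp (∀P p))
  ... | no ¬∃ = yes (λ p → helper p)
    where
    helper : ∀ p → P p
    helper p with P? p
    ... | yes Pp = Pp
    ... | no ¬Pp = Data.Empty.⊥-elim (¬∃ (p , ¬Pp))
      where import Data.Empty

intersecting? : (k : ℕ) (𝓕 : Family k) → Dec (Intersecting k 𝓕)
intersecting? k 𝓕 = all? (λ i → all? (λ j →
  (i ∈? 𝓕) →-dec ((j ∈? 𝓕) →-dec nonempty? (set k i ∩ set k j))))

leftCompressed? : (k : ℕ) (𝓕 : Family k) → Dec (LeftCompressed k 𝓕)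
leftCompressed? k 𝓕 = all? (λ i → all? (λ j →
  (i ∈? 𝓕) →-dec (decidable (λ y x → toℕ y ≤? toℕ x) (elems (set k j)) (elems (set k i)) →-dec (j ∈? 𝓕))))

LCI? : (k : ℕ) (𝓕 : Family k) → Dec (LCI k 𝓕)
LCI? k 𝓕 = intersecting? k 𝓕 ×-dec leftCompressed? k 𝓕

IsMLCIF? : (k : ℕ) (𝓕 : Family k) → Dec (IsMLCIF k 𝓕)
IsMLCIF? k 𝓕 = LCI? k 𝓕 ×-dec allSubset? (λ 𝓖 → LCI? k 𝓖 →-dec ((𝓕 ⊆? 𝓖) →-dec (𝓖 ≟S 𝓕)))

IsPk? : (k : ℕ) (𝓐 : Family k) → Dec (IsPk k 𝓐)
IsPk? k 𝓐 = Data.Fin.Properties.any? (λ i → Data.Fin.Properties.any? (λ j →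
  (set k j ≟S ∁ (set k i)) ×-dec ((ΣF (set k i) ≟ (k * (2 * k + 1)) / 2)
  ×-dec ((ΣF (set k j) ≟ (k * (2 * k + 1)) / 2) ×-dec (𝓐 ≟S (⁅ i ⁆ ∪ ⁅ j ⁆))))))
  where import Data.Fin.Properties

∣M∣ : ℕ → ℕ
∣M∣ k = length (filter (IsMLCIF? k) (allSubsets (length (KSets k))))

∣P∣ : ℕ → ℕ
∣P∣ k = length (filter (IsPk? k) (allSubsets (length (KSets k))))

{-# OPTIONS --safe #-}
-- For even k put H = k(2k+1)/2, so that Σ(F) + Σ(F^c) = 2H for every k-set F.  If F' ≼ F
-- then Σ(F') ≤ Σ(F), with equality only for F' = F, and the k-sets with Σ(F) = H are exactly
-- the members of the pairs in 𝓟_k.  So choosing one member of each pair of 𝓟_k and adding all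
-- F with Σ(F) < H yields a left-compressed family containing exactly one of F, F^c for every
-- k-set F.  Since two disjoint k-subsets of [2k] are complementary, such a family is
-- intersecting and maximal.  Distinct choices give distinct families: 2^|𝓟_k| of them.
module Submission where

open import Defs
open import Data.Nat using (ℕ; zero; suc; _+_; _*_; _/_; _^_; _≤_; _<_; _<?_; z≤n; s≤s)
open import Data.Nat.Divisibility using (_∣_; ∣m⇒∣m*n)

open import Data.Bool as Bool using (Bool; not)
open import Data.Bool.Properties using (T-≡; not-¬; ¬-not)
open import Data.Empty using (⊥-elim)
open import Data.Fin as Fin using (Fin; toℕ)
import Data.Fin.Properties as Fin
open import Data.Fin.Subset
  using (Subset; inside; outside; _∈_; _∉_; _⊆_; _∩_; _∪_; ∁; ⁅_⁆; Nonempty; ∣_∣)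
open import Data.Fin.Subset.Properties
  using ( _∈?_; nonempty?; drop-∷-⊆; p⊆q⇒∣p∣≤∣q∣; ∣p∣≤n; ∣∁p∣≡n∸∣p∣; x∈p⇒x∉∁p; x∉p⇒x∈∁p
        ; x∈p∩q⁺; x∈p∩q⁻; x∈p∪q⁻; x∈⁅x⁆; x∈⁅y⁆⇒x≡y; p⊆p∪q; q⊆p∪q; ∪-comm; ⊆-antisym
        ; ∪-∩-booleanAlgebra)
open import Algebra.Lattice.Properties.BooleanAlgebra using (¬-involutive)
open import Data.List using (List; []; _∷_; map; length; filter; lookup; _++_)
open import Data.List.Properties using (length-++; length-map; map-∘; map-injective; ∷-injective)
open import Data.List.Membership.Propositional using () renaming (_∈_ to _∈ₗ_)
open import Data.List.Membership.Propositional.Properties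
  using (∈-lookup; ∈-filter⁺; ∈-map⁺; ∈-map⁻; ∈-++⁺ˡ; ∈-++⁺ʳ)
open import Data.List.Relation.Unary.All as All using ()
open import Data.List.Relation.Unary.All.Properties using (all-filter)
open import Data.List.Relation.Unary.Any as Any using (here)
open import Data.List.Relation.Unary.Any.Properties using (lookup-index)
open import Data.List.Relation.Unary.AllPairs using ([]; _∷_)
open import Data.List.Relation.Unary.Unique.Propositional using (Unique)
import Data.List.Relation.Unary.Unique.Propositional.Properties as Unique
open import Data.List.Relation.Binary.Pointwise as Pointwise using (Pointwise; []; _∷_)
open import Data.Nat.Properties
open import Algebra.Properties.CommutativeSemigroup +-commutativeSemigroup
  using () renaming (interchange to +-interchange; x∙yz≈y∙xz to +-exchange)
open import Data.Nat.DivMod using (m*[n/m]≡n)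
open import Data.Nat.ListAction using (sum)
open import Data.Product using (_×_; _,_; ∃-syntax; proj₁; proj₂)
open import Data.Sum as Sum using (_⊎_; inj₁; inj₂; [_,_]′)
open import Data.Vec as Vec using ([]; _∷_; tabulate)
open import Data.Vec.Properties
  using (lookup-map; lookup∘tabulate; tabulate∘lookup; tabulate-cong; lookup⇒[]=; []=⇒lookup)
  renaming (∷-injectiveʳ to Vec-∷-injectiveʳ)
open import Function using (_∘_; Injective; Equivalence)
open import Relation.Binary.Definitions using (Tri; tri<; tri≈; tri>)
open import Relation.Binary.PropositionalEquality
open import Relation.Nullary using (¬_; yes; no; isYes)
open import Relation.Nullary.Decidable using (toWitness; fromWitness; _×-dec_; _⊎-dec_)
open import Level using (0ℓ)
open import Relation.Unary using (Pred; Decidable)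

lookup-injective : ∀ {A : Set} {xs : List A} → Unique xs →
                   ∀ i j → lookup xs i ≡ lookup xs j → i ≡ j
lookup-injective (_ ∷ _) Fin.zero Fin.zero _ = refl
lookup-injective (x∉xs ∷ _) Fin.zero (Fin.suc j) eq = ⊥-elim (All.lookup x∉xs (∈-lookup j) eq)
lookup-injective (x∉xs ∷ _) (Fin.suc i) Fin.zero eq = ⊥-elim (All.lookup x∉xs (∈-lookup i) (sym eq))
lookup-injective (_ ∷ u) (Fin.suc i) (Fin.suc j) eq = cong Fin.suc (lookup-injective u i j eq)

length-≤-injection : ∀ {A B : Set} {xs : List A} {ys : List B} (f : A → B) →
                     Unique xs → Injective _≡_ _≡_ f → (∀ {x} → x ∈ₗ xs → f x ∈ₗ ys) →
                     length xs ≤ length ys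
length-≤-injection {xs = xs} {ys} f xs! f-inj f∈ys = Fin.injective⇒≤ g-injective
  where
  g : Fin (length xs) → Fin (length ys)
  g i = Any.index (f∈ys (∈-lookup i))

  f∘lookup≡lookup∘g : ∀ i → f (lookup xs i) ≡ lookup ys (g i)
  f∘lookup≡lookup∘g i = lookup-index (f∈ys (∈-lookup i))

  g-injective : Injective _≡_ _≡_ g
  g-injective {i} {j} gi≡gj = lookup-injective xs! i j (f-inj (begin
    f (lookup xs i)  ≡⟨ f∘lookup≡lookup∘g i ⟩
    lookup ys (g i)  ≡⟨ cong (lookup ys) gi≡gj ⟩
    lookup ys (g j)  ≡⟨ f∘lookup≡lookup∘g j ⟨
    f (lookup xs j)  ∎))
    where open ≡-Reasoning

module _ {A : Set} {P : Pred A 0ℓ} (P? : Decidable P) where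

  lookup-filter : ∀ xs l → P (lookup (filter P? xs) l)
  lookup-filter xs l = All.lookup (all-filter P? xs) (∈-lookup l)

  index-filter : ∀ {x xs} → x ∈ₗ xs → P x → ∃[ l ] lookup (filter P? xs) l ≡ x
  index-filter x∈xs px = Any.index x∈filter , sym (lookup-index x∈filter)
    where x∈filter = ∈-filter⁺ P? x∈xs px

module _ {n : ℕ} {P : Pred (Fin n) 0ℓ} (P? : Decidable P) where

  satisfying : Subset n
  satisfying = tabulate (isYes ∘ P?)

  ∈-satisfying⁺ : ∀ {x} → P x → x ∈ satisfying
  ∈-satisfying⁺ {x} px =
    lookup⇒[]= x satisfying (trans (lookup∘tabulate _ x) (Equivalence.to T-≡ (fromWitness px)))

  ∈-satisfying⁻ : ∀ {x} → x ∈ satisfying → P x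
  ∈-satisfying⁻ {x} x∈ =
    toWitness {a? = P? x} (Equivalence.from T-≡ (trans (sym (lookup∘tabulate _ x)) ([]=⇒lookup x∈)))

length-allSubsets : ∀ n → length (allSubsets n) ≡ 2 ^ n
length-allSubsets zero = refl
length-allSubsets (suc n) = begin
  length (map (inside ∷_) (allSubsets n) ++ map (outside ∷_) (allSubsets n))
    ≡⟨ length-++ (map (inside ∷_) (allSubsets n)) ⟩
  length (map (inside ∷_) (allSubsets n)) + length (map (outside ∷_) (allSubsets n))
    ≡⟨ cong₂ _+_ (length-map _ (allSubsets n)) (length-map _ (allSubsets n)) ⟩
  length (allSubsets n) + length (allSubsets n)
    ≡⟨ cong₂ _+_ (length-allSubsets n) (length-allSubsets n) ⟩
  2 ^ n + 2 ^ n
    ≡⟨ cong (2 ^ n +_) (+-identityʳ (2 ^ n)) ⟨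
  2 ^ suc n ∎
  where open ≡-Reasoning

∈-allSubsets : ∀ {n} (p : Subset n) → p ∈ₗ allSubsets n
∈-allSubsets [] = here refl
∈-allSubsets (inside ∷ p) = ∈-++⁺ˡ (∈-map⁺ (inside ∷_) (∈-allSubsets p))
∈-allSubsets (outside ∷ p) = ∈-++⁺ʳ (map (inside ∷_) _) (∈-map⁺ (outside ∷_) (∈-allSubsets p))

allSubsets-unique : ∀ n → Unique (allSubsets n)
allSubsets-unique zero = All.[] ∷ []
allSubsets-unique (suc n) =
  Unique.++⁺ (Unique.map⁺ Vec-∷-injectiveʳ (allSubsets-unique n))
             (Unique.map⁺ Vec-∷-injectiveʳ (allSubsets-unique n))
             disjoint
  where
  disjoint : ∀ {p} → ¬ (p ∈ₗ map (inside ∷_) (allSubsets n) × p ∈ₗ map (outside ∷_) (allSubsets n))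
  disjoint (p∈ins , p∈outs) with ∈-map⁻ (inside ∷_) p∈ins | ∈-map⁻ (outside ∷_) p∈outs
  ... | _ , _ , refl | _ , _ , ()

∣p∣+∣∁p∣≡n : ∀ {n} (p : Subset n) → ∣ p ∣ + ∣ ∁ p ∣ ≡ n
∣p∣+∣∁p∣≡n p = trans (cong (∣ p ∣ +_) (∣∁p∣≡n∸∣p∣ p)) (m+[n∸m]≡n (∣p∣≤n p))

p⊆q∧∣q∣≤∣p∣⇒p≡q : ∀ {n} {p q : Subset n} → p ⊆ q → ∣ q ∣ ≤ ∣ p ∣ → p ≡ q
p⊆q∧∣q∣≤∣p∣⇒p≡q {p = []} {[]} _ _ = refl
p⊆q∧∣q∣≤∣p∣⇒p≡q {p = inside ∷ p} {inside ∷ q} p⊆q (s≤s ∣q∣≤∣p∣) =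
  cong (inside ∷_) (p⊆q∧∣q∣≤∣p∣⇒p≡q (drop-∷-⊆ p⊆q) ∣q∣≤∣p∣)
p⊆q∧∣q∣≤∣p∣⇒p≡q {p = outside ∷ p} {outside ∷ q} p⊆q ∣q∣≤∣p∣ =
  cong (outside ∷_) (p⊆q∧∣q∣≤∣p∣⇒p≡q (drop-∷-⊆ p⊆q) ∣q∣≤∣p∣)
p⊆q∧∣q∣≤∣p∣⇒p≡q {p = inside ∷ p} {outside ∷ q} p⊆q _ with () ← p⊆q Vec.here
p⊆q∧∣q∣≤∣p∣⇒p≡q {p = outside ∷ p} {inside ∷ q} p⊆q ∣q∣≤∣p∣ =
  ⊥-elim (<⇒≱ (s≤s (p⊆q⇒∣p∣≤∣q∣ (drop-∷-⊆ p⊆q))) ∣q∣≤∣p∣)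

disjoint⇒⊆∁ : ∀ {n} (p q : Subset n) → ¬ Nonempty (p ∩ q) → q ⊆ ∁ p
disjoint⇒⊆∁ p q p∩q=∅ {x} x∈q with x ∈? p
... | yes x∈p = ⊥-elim (p∩q=∅ (x , x∈p∩q⁺ (x∈p , x∈q)))
... | no x∉p = x∉p⇒x∈∁p x∉p

∁-involutive : ∀ {n} (p : Subset n) → ∁ (∁ p) ≡ p
∁-involutive {n} = ¬-involutive (∪-∩-booleanAlgebra n)

length-elems : ∀ {n} (p : Subset n) → length (elems p) ≡ ∣ p ∣
length-elems [] = refl
length-elems (inside ∷ p) = cong suc (trans (length-map Fin.suc (elems p)) (length-elems p))
length-elems (outside ∷ p) = trans (length-map Fin.suc (elems p)) (length-elems p)

elems-injective : ∀ {n} {p q : Subset n} → elems p ≡ elems q → p ≡ q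
elems-injective {p = []} {[]} _ = refl
elems-injective {p = inside ∷ p} {inside ∷ q} eq =
  cong (inside ∷_) (elems-injective (map-injective Fin.suc-injective (proj₂ (∷-injective eq))))
elems-injective {p = outside ∷ p} {outside ∷ q} eq =
  cong (outside ∷_) (elems-injective (map-injective Fin.suc-injective eq))
elems-injective {p = inside ∷ p} {outside ∷ q} eq with elems q | eq
... | [] | ()
... | _ ∷ _ | ()
elems-injective {p = outside ∷ p} {inside ∷ q} eq with elems p | eq
... | [] | ()
... | _ ∷ _ | ()

sum-map-suc : ∀ ns → sum (map suc ns) ≡ length ns + sum ns
sum-map-suc [] = refl
sum-map-suc (n ∷ ns) = begin
  suc n + sum (map suc ns)       ≡⟨ cong (suc n +_) (sum-map-suc ns) ⟩
  suc n + (length ns + sum ns)   ≡⟨ cong suc (+-exchange n (length ns) (sum ns)) ⟩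
  suc (length ns + (n + sum ns)) ∎
  where open ≡-Reasoning

ΣF-outside∷ : ∀ {n} (p : Subset n) → ΣF (outside ∷ p) ≡ ∣ p ∣ + ΣF p
ΣF-outside∷ p = begin
  sum (map (suc ∘ toℕ) (map Fin.suc (elems p)))  ≡⟨ cong sum (map-∘ (elems p)) ⟨
  sum (map (suc ∘ suc ∘ toℕ) (elems p))          ≡⟨ cong sum (map-∘ (elems p)) ⟩
  sum (map suc (map (suc ∘ toℕ) (elems p)))      ≡⟨ sum-map-suc (map (suc ∘ toℕ) (elems p)) ⟩
  length (map (suc ∘ toℕ) (elems p)) + ΣF p      ≡⟨ cong (_+ ΣF p) (length-map (suc ∘ toℕ) (elems p)) ⟩
  length (elems p) + ΣF p                        ≡⟨ cong (_+ ΣF p) (length-elems p) ⟩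
  ∣ p ∣ + ΣF p                                   ∎
  where open ≡-Reasoning

ΣF-∷ : ∀ {n} b (p : Subset n) → ΣF (b ∷ p) ≡ ∣ b ∷ p ∣ + ΣF p
ΣF-∷ inside p = cong suc (ΣF-outside∷ p)
ΣF-∷ outside p = ΣF-outside∷ p

-- Σ(F) + Σ(F^c) = 1 + ⋯ + n, doubled to stay in ℕ without division.
ΣF+ΣF∁ : ∀ {n} (p : Subset n) → 2 * (ΣF p + ΣF (∁ p)) ≡ n * suc n
ΣF+ΣF∁ [] = refl
ΣF+ΣF∁ {suc n} (b ∷ p) = begin
  2 * (ΣF (b ∷ p) + ΣF (not b ∷ ∁ p))
    ≡⟨ cong (2 *_) (cong₂ _+_ (ΣF-∷ b p) (ΣF-∷ (not b) (∁ p))) ⟩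
  2 * ((∣ b ∷ p ∣ + ΣF p) + (∣ ∁ (b ∷ p) ∣ + ΣF (∁ p)))
    ≡⟨ cong (2 *_) (+-interchange (∣ b ∷ p ∣) (ΣF p) (∣ ∁ (b ∷ p) ∣) (ΣF (∁ p))) ⟩
  2 * ((∣ b ∷ p ∣ + ∣ ∁ (b ∷ p) ∣) + (ΣF p + ΣF (∁ p)))
    ≡⟨ cong (λ m → 2 * (m + (ΣF p + ΣF (∁ p)))) (∣p∣+∣∁p∣≡n (b ∷ p)) ⟩
  2 * (suc n + (ΣF p + ΣF (∁ p)))
    ≡⟨ *-distribˡ-+ 2 (suc n) _ ⟩
  2 * suc n + 2 * (ΣF p + ΣF (∁ p))
    ≡⟨ cong (2 * suc n +_) (ΣF+ΣF∁ p) ⟩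
  2 * suc n + n * suc n
    ≡⟨ *-distribʳ-+ (suc n) 2 n ⟨
  (2 + n) * suc n
    ≡⟨ *-comm (2 + n) (suc n) ⟩
  suc n * suc (suc n) ∎
  where open ≡-Reasoning

sum-mono-≤ : ∀ {ms ns} → Pointwise _≤_ ms ns → sum ms ≤ sum ns
sum-mono-≤ [] = z≤n
sum-mono-≤ (m≤n ∷ ms≤ns) = +-mono-≤ m≤n (sum-mono-≤ ms≤ns)

sum-mono-≤-≡⇒≡ : ∀ {ms ns} → Pointwise _≤_ ms ns → sum ms ≡ sum ns → ms ≡ ns
sum-mono-≤-≡⇒≡ [] _ = refl
sum-mono-≤-≡⇒≡ {m ∷ ms} {n ∷ ns} (m≤n ∷ ms≤ns) eq = cong₂ _∷_ m≡n (sum-mono-≤-≡⇒≡ ms≤ns Σms≡Σns)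
  where
  m≡n : m ≡ n
  m≡n = ≤-antisym m≤n (+-cancelʳ-≤ (sum ns) n m (begin
    n + sum ns ≡⟨ eq ⟨
    m + sum ms ≤⟨ +-monoʳ-≤ m (sum-mono-≤ ms≤ns) ⟩
    m + sum ns ∎))
    where open ≤-Reasoning
  Σms≡Σns : sum ms ≡ sum ns
  Σms≡Σns = +-cancelˡ-≡ m (sum ms) (sum ns) (trans eq (cong (_+ sum ns) (sym m≡n)))

≼⇒ΣF-pointwise : ∀ {n} {p q : Subset n} → p ≼ q →
                 Pointwise _≤_ (map (suc ∘ toℕ) (elems p)) (map (suc ∘ toℕ) (elems q))
≼⇒ΣF-pointwise p≼q = Pointwise.map⁺ (suc ∘ toℕ) (suc ∘ toℕ) (Pointwise.map s≤s p≼q)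

≼⇒ΣF≤ : ∀ {n} {p q : Subset n} → p ≼ q → ΣF p ≤ ΣF q
≼⇒ΣF≤ {p = p} {q} p≼q = sum-mono-≤ (≼⇒ΣF-pointwise {p = p} {q} p≼q)

≼∧ΣF≡⇒≡ : ∀ {n} {p q : Subset n} → p ≼ q → ΣF p ≡ ΣF q → p ≡ q
≼∧ΣF≡⇒≡ {p = p} {q} p≼q eq = elems-injective (map-injective (Fin.toℕ-injective ∘ suc-injective)
                                                (sum-mono-≤-≡⇒≡ (≼⇒ΣF-pointwise {p = p} {q} p≼q) eq))

n/2+n/2≡n : ∀ {n} → 2 ∣ n → n / 2 + n / 2 ≡ n
n/2+n/2≡n {n} 2∣n = trans (cong (n / 2 +_) (sym (+-identityʳ (n / 2)))) (m*[n/m]≡n 2∣n)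

m≤o∧n≤o∧m+n≡o+o⇒m≡o : ∀ {m n o} → m ≤ o → n ≤ o → m + n ≡ o + o → m ≡ o
m≤o∧n≤o∧m+n≡o+o⇒m≡o {m} {n} {o} m≤o n≤o eq = ≤-antisym m≤o (+-cancelʳ-≤ o o m (begin
  o + o ≡⟨ eq ⟨
  m + n ≤⟨ +-monoʳ-≤ m n≤o ⟩
  m + o ∎))
  where open ≤-Reasoning

module KSetFamilies (k : ℕ) where

  N : ℕ
  N = length (KSets k)

  set-injective : ∀ {i j} → set k i ≡ set k j → i ≡ j
  set-injective = lookup-injective (Unique.filter⁺ (λ A → ∣ A ∣ ≟ k) (allSubsets-unique (2 * k))) _ _

  ∣set∣≡k : ∀ i → ∣ set k i ∣ ≡ k
  ∣set∣≡k = lookup-filter (λ A → ∣ A ∣ ≟ k) (allSubsets (2 * k))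

  set-surjective : ∀ {A} → ∣ A ∣ ≡ k → ∃[ i ] set k i ≡ A
  set-surjective {A} = index-filter (λ A → ∣ A ∣ ≟ k) (∈-allSubsets A)

  ∣∁set∣≡k : ∀ i → ∣ ∁ (set k i) ∣ ≡ k
  ∣∁set∣≡k i = +-cancelˡ-≡ k _ _ (begin
    k + ∣ ∁ (set k i) ∣          ≡⟨ cong (_+ ∣ ∁ (set k i) ∣) (∣set∣≡k i) ⟨
    ∣ set k i ∣ + ∣ ∁ (set k i) ∣ ≡⟨ ∣p∣+∣∁p∣≡n (set k i) ⟩
    2 * k                        ≡⟨ cong (k +_) (+-identityʳ k) ⟩
    k + k                        ∎)
    where open ≡-Reasoning

  opaque
    comp : Fin N → Fin N
    comp i = proj₁ (set-surjective {∁ (set k i)} (∣∁set∣≡k i))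

    set-comp : ∀ i → set k (comp i) ≡ ∁ (set k i)
    set-comp i = proj₂ (set-surjective {∁ (set k i)} (∣∁set∣≡k i))

  ≡comp : ∀ {i j} → set k j ≡ ∁ (set k i) → j ≡ comp i
  ≡comp {i} eq = set-injective (trans eq (sym (set-comp i)))

  comp-involutive : ∀ i → comp (comp i) ≡ i
  comp-involutive i = sym (≡comp (begin
    set k i              ≡⟨ ∁-involutive (set k i) ⟨
    ∁ (∁ (set k i))      ≡⟨ cong ∁ (set-comp i) ⟨
    ∁ (set k (comp i))   ∎))
    where open ≡-Reasoning

  comp-disjoint : ∀ i → ¬ Nonempty (set k i ∩ set k (comp i))
  comp-disjoint i (x , x∈i∩ci) with x∈p∩q⁻ (set k i) (set k (comp i)) x∈i∩ci
  ... | x∈i , x∈ci = x∈p⇒x∉∁p x∈i (subst (x ∈_) (set-comp i) x∈ci)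

  disjoint⇒comp : ∀ {i j} → ¬ Nonempty (set k i ∩ set k j) → j ≡ comp i
  disjoint⇒comp {i} {j} i∩j=∅ = ≡comp (p⊆q∧∣q∣≤∣p∣⇒p≡q (disjoint⇒⊆∁ (set k i) (set k j) i∩j=∅)
                                                    (≤-reflexive (trans (∣∁set∣≡k i) (sym (∣set∣≡k j)))))

  complement-free⇒intersecting : (𝓕 : Family k) → (∀ {i} → i ∈ 𝓕 → comp i ∉ 𝓕) → Intersecting k 𝓕
  complement-free⇒intersecting 𝓕 free i j i∈𝓕 j∈𝓕 with nonempty? (set k i ∩ set k j)
  ... | yes i∩j≠∅ = i∩j≠∅
  ... | no i∩j=∅ = ⊥-elim (free i∈𝓕 (subst (_∈ 𝓕) (disjoint⇒comp i∩j=∅) j∈𝓕))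

  complement-full⇒maximal : (𝓕 : Family k) → (∀ i → i ∈ 𝓕 ⊎ comp i ∈ 𝓕) →
                            ∀ 𝓖 → Intersecting k 𝓖 → 𝓕 ⊆ 𝓖 → 𝓖 ≡ 𝓕
  complement-full⇒maximal 𝓕 full 𝓖 𝓖-intersecting 𝓕⊆𝓖 = ⊆-antisym 𝓖⊆𝓕 𝓕⊆𝓖
    where
    𝓖⊆𝓕 : 𝓖 ⊆ 𝓕
    𝓖⊆𝓕 {i} i∈𝓖 = [ (λ i∈𝓕 → i∈𝓕)
                   , (λ ci∈𝓕 → ⊥-elim (comp-disjoint i (𝓖-intersecting i (comp i) i∈𝓖 (𝓕⊆𝓖 ci∈𝓕))))
                   ]′ (full i)

  σ : Fin N → ℕ
  σ i = ΣF (set k i)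

  H : ℕ
  H = k * (2 * k + 1) / 2

  σ+σ∘comp≡k[2k+1] : ∀ i → σ i + σ (comp i) ≡ k * (2 * k + 1)
  σ+σ∘comp≡k[2k+1] i = *-cancelˡ-≡ _ _ 2 (begin
    2 * (σ i + ΣF (set k (comp i)))    ≡⟨ cong (λ A → 2 * (σ i + ΣF A)) (set-comp i) ⟩
    2 * (σ i + ΣF (∁ (set k i)))       ≡⟨ ΣF+ΣF∁ (set k i) ⟩
    2 * k * suc (2 * k)                ≡⟨ *-assoc 2 k (suc (2 * k)) ⟩
    2 * (k * suc (2 * k))              ≡⟨ cong (λ n → 2 * (k * n)) (+-comm 1 (2 * k)) ⟩
    2 * (k * (2 * k + 1))              ∎)
    where open ≡-Reasoning

  pair-members : ∀ {𝓟 x} → IsPk k 𝓟 → x ∈ 𝓟 → 𝓟 ≡ ⁅ x ⁆ ∪ ⁅ comp x ⁆ × σ x ≡ H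
  pair-members (i , j , j-comp , σi≡H , σj≡H , refl) x∈𝓟 with x∈p∪q⁻ ⁅ i ⁆ ⁅ j ⁆ x∈𝓟
  ... | inj₁ x∈⁅i⁆ with refl ← x∈⁅y⁆⇒x≡y i x∈⁅i⁆ =
    cong (λ y → ⁅ i ⁆ ∪ ⁅ y ⁆) (≡comp j-comp) , σi≡H
  ... | inj₂ x∈⁅j⁆ with refl ← x∈⁅y⁆⇒x≡y j x∈⁅j⁆ =
    trans (∪-comm ⁅ i ⁆ ⁅ j ⁆) (cong (λ y → ⁅ j ⁆ ∪ ⁅ y ⁆) i≡comp-j) , σj≡H
    where
    i≡comp-j : i ≡ comp j
    i≡comp-j = trans (sym (comp-involutive i)) (cong comp (sym (≡comp j-comp)))

  pairs : List (Family k)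
  pairs = filter (IsPk? k) (allSubsets N)

  pairs-IsPk : ∀ l → IsPk k (lookup pairs l)
  pairs-IsPk = lookup-filter (IsPk? k) (allSubsets N)

  ∈pair⇒σ≡H : ∀ {x} l → x ∈ lookup pairs l → σ x ≡ H
  ∈pair⇒σ≡H l x∈ = proj₂ (pair-members (pairs-IsPk l) x∈)

  comp-∈pair : ∀ {x} l → x ∈ lookup pairs l → comp x ∈ lookup pairs l
  comp-∈pair {x} l x∈ = subst (comp x ∈_) (sym (proj₁ (pair-members (pairs-IsPk l) x∈)))
                              (q⊆p∪q ⁅ x ⁆ ⁅ comp x ⁆ (x∈⁅x⁆ (comp x)))

  pair-unique : ∀ {x} l l′ → x ∈ lookup pairs l → x ∈ lookup pairs l′ → l ≡ l′
  pair-unique l l′ x∈l x∈l′ =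
    lookup-injective (Unique.filter⁺ (IsPk? k) (allSubsets-unique N)) l l′
      (trans (proj₁ (pair-members (pairs-IsPk l) x∈l)) (sym (proj₁ (pair-members (pairs-IsPk l′) x∈l′))))

  pair-inhabited : ∀ {𝓟} → IsPk k 𝓟 → ∃[ x ] x ∈ 𝓟
  pair-inhabited (i , j , _ , _ , _ , refl) = i , p⊆p∪q ⁅ j ⁆ (x∈⁅x⁆ i)

module Choices (k : ℕ) (k-even : 2 ∣ k) (x₀ : Fin (2 * k)) where

  open KSetFamilies k

  m : ℕ
  m = length pairs

  σ+σ∘comp≡H+H : ∀ i → σ i + σ (comp i) ≡ H + H
  σ+σ∘comp≡H+H i =
    trans (σ+σ∘comp≡k[2k+1] i) (sym (n/2+n/2≡n (∣m⇒∣m*n (2 * k + 1) k-even)))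

  σ≡H⇒σ∘comp≡H : ∀ {i} → σ i ≡ H → σ (comp i) ≡ H
  σ≡H⇒σ∘comp≡H {i} σi≡H =
    +-cancelˡ-≡ H _ _ (trans (cong (_+ σ (comp i)) (sym σi≡H)) (σ+σ∘comp≡H+H i))

  σ>H⇒σ∘comp<H : ∀ {i} → H < σ i → σ (comp i) < H
  σ>H⇒σ∘comp<H {i} H<σi = +-cancelˡ-< H (σ (comp i)) H (begin-strict
    H + σ (comp i)   <⟨ +-monoˡ-< (σ (comp i)) H<σi ⟩
    σ i + σ (comp i) ≡⟨ σ+σ∘comp≡H+H i ⟩
    H + H            ∎)
    where open ≤-Reasoning

  σ≡H⇒∈pair : ∀ {i} → σ i ≡ H → ∃[ l ] i ∈ lookup pairs l
  σ≡H⇒∈pair {i} σi≡H =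
    let l , eq = index-filter (IsPk? k) (∈-allSubsets (⁅ i ⁆ ∪ ⁅ comp i ⁆))
                   (i , comp i , set-comp i , σi≡H , σ≡H⇒σ∘comp≡H σi≡H , refl)
    in l , subst (i ∈_) (sym eq) (p⊆p∪q ⁅ comp i ⁆ (x∈⁅x⁆ i))

  side : Fin N → Bool
  side i = Vec.lookup (set k i) x₀

  side∘comp : ∀ i → side (comp i) ≡ not (side i)
  side∘comp i = trans (cong (λ A → Vec.lookup A x₀) (set-comp i)) (lookup-map x₀ not (set k i))

  side-or-comp : ∀ x b → side x ≡ b ⊎ side (comp x) ≡ b
  side-or-comp x b with side x Bool.≟ b
  ... | yes side-x≡b = inj₁ side-x≡b
  ... | no side-x≢b = inj₂ (trans (side∘comp x) (sym (¬-not (side-x≢b ∘ sym))))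

  -- c picks from the l-th pair of 𝓟_k the member F with (x₀ ∈ F) = c[l].
  ChosenVia : Subset m → Fin m → Fin N → Set
  ChosenVia c l i = i ∈ lookup pairs l × Vec.lookup c l ≡ side i

  Chosen : Subset m → Fin N → Set
  Chosen c i = ∃[ l ] ChosenVia c l i

  ChosenVia⊎ChosenVia∘comp : ∀ c l {i} → i ∈ lookup pairs l → ChosenVia c l i ⊎ ChosenVia c l (comp i)
  ChosenVia⊎ChosenVia∘comp c l {i} i∈l =
    Sum.map (λ side-i≡cₗ → i∈l , sym side-i≡cₗ) (λ side-ci≡cₗ → comp-∈pair l i∈l , sym side-ci≡cₗ)
            (side-or-comp i (Vec.lookup c l))

  pair-has-chosen : ∀ c l → ∃[ x ] ChosenVia c l x
  pair-has-chosen c l = chosen-in (pair-inhabited (pairs-IsPk l))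
    where
    chosen-in : ∃[ x ] x ∈ lookup pairs l → ∃[ x ] ChosenVia c l x
    chosen-in (x , x∈l) = [ (x ,_) , (comp x ,_) ]′ (ChosenVia⊎ChosenVia∘comp c l x∈l)

  Member : Subset m → Fin N → Set
  Member c i = σ i < H ⊎ Chosen c i

  member? : ∀ c → Decidable (Member c)
  member? c i =
    (σ i <? H) ⊎-dec Fin.any? (λ l → (i ∈? lookup pairs l) ×-dec (Vec.lookup c l Bool.≟ side i))

  family : Subset m → Family k
  family c = satisfying (member? c)

  ∈family⁺ : ∀ c {i} → Member c i → i ∈ family c
  ∈family⁺ c = ∈-satisfying⁺ (member? c)

  ∈family⁻ : ∀ c {i} → i ∈ family c → Member c i
  ∈family⁻ c = ∈-satisfying⁻ (member? c)

  Member⇒σ≤H : ∀ c {i} → Member c i → σ i ≤ H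
  Member⇒σ≤H _ (inj₁ σi<H) = <⇒≤ σi<H
  Member⇒σ≤H _ (inj₂ (l , i∈l , _)) = ≤-reflexive (∈pair⇒σ≡H l i∈l)

  Member∧σ≡H⇒Chosen : ∀ c {i} → Member c i → σ i ≡ H → Chosen c i
  Member∧σ≡H⇒Chosen _ (inj₁ σi<H) σi≡H = ⊥-elim (<-irrefl σi≡H σi<H)
  Member∧σ≡H⇒Chosen _ (inj₂ chosen) _ = chosen

  Chosen⇒¬Chosen∘comp : ∀ c {i} → Chosen c i → ¬ Chosen c (comp i)
  Chosen⇒¬Chosen∘comp c {i} (l , i∈l , cₗ≡side-i) (l′ , ci∈l′ , cₗ′≡side-ci) = not-¬ refl (begin
    side i          ≡⟨ cₗ≡side-i ⟨
    Vec.lookup c l  ≡⟨ cong (Vec.lookup c) (pair-unique l l′ (comp-∈pair l i∈l) ci∈l′) ⟩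
    Vec.lookup c l′ ≡⟨ cₗ′≡side-ci ⟩
    side (comp i)   ≡⟨ side∘comp i ⟩
    not (side i)    ∎)
    where open ≡-Reasoning

  Member⇒¬Member∘comp : ∀ c {i} → Member c i → ¬ Member c (comp i)
  Member⇒¬Member∘comp c {i} i∈ ci∈ =
    Chosen⇒¬Chosen∘comp c (Member∧σ≡H⇒Chosen c i∈ σi≡H) (Member∧σ≡H⇒Chosen c ci∈ (σ≡H⇒σ∘comp≡H σi≡H))
    where
    σi≡H : σ i ≡ H
    σi≡H = m≤o∧n≤o∧m+n≡o+o⇒m≡o (Member⇒σ≤H c i∈) (Member⇒σ≤H c ci∈) (σ+σ∘comp≡H+H i)

  Member⊎Member∘comp : ∀ c i → Member c i ⊎ Member c (comp i)
  Member⊎Member∘comp c i = by-trichotomy (<-cmp (σ i) H)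
    where
    by-trichotomy : Tri (σ i < H) (σ i ≡ H) (H < σ i) → Member c i ⊎ Member c (comp i)
    by-trichotomy (tri< σi<H _ _) = inj₁ (inj₁ σi<H)
    by-trichotomy (tri> _ _ H<σi) = inj₂ (inj₁ (σ>H⇒σ∘comp<H H<σi))
    by-trichotomy (tri≈ _ σi≡H _) =
      Sum.map (inj₂ ∘ (l ,_)) (inj₂ ∘ (l ,_)) (ChosenVia⊎ChosenVia∘comp c l (proj₂ (σ≡H⇒∈pair σi≡H)))
      where l = proj₁ (σ≡H⇒∈pair σi≡H)

  family-leftCompressed : ∀ c → LeftCompressed k (family c)
  family-leftCompressed c i j i∈ j≼i =
    [ (λ σj<σi → ∈family⁺ c (inj₁ (<-≤-trans σj<σi (Member⇒σ≤H c (∈family⁻ c i∈)))))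
    , (λ σj≡σi → subst (_∈ family c)
                        (sym (set-injective (≼∧ΣF≡⇒≡ {p = set k j} {set k i} j≼i σj≡σi))) i∈)
    ]′ (m≤n⇒m<n∨m≡n (≼⇒ΣF≤ {p = set k j} {set k i} j≼i))

  family-isMLCIF : ∀ c → IsMLCIF k (family c)
  family-isMLCIF c = (intersecting , family-leftCompressed c) , maximal
    where
    intersecting : Intersecting k (family c)
    intersecting = complement-free⇒intersecting (family c)
                     (λ i∈ ci∈ → Member⇒¬Member∘comp c (∈family⁻ c i∈) (∈family⁻ c ci∈))
    maximal : ∀ 𝓖 → LCI k 𝓖 → family c ⊆ 𝓖 → 𝓖 ≡ family c
    maximal 𝓖 (𝓖-intersecting , _) =
      complement-full⇒maximal (family c)
        (λ i → Sum.map (∈family⁺ c) (∈family⁺ c) (Member⊎Member∘comp c i)) 𝓖 𝓖-intersecting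

  ChosenVia∧Member⇒≡ : ∀ c c′ {l x} → ChosenVia c l x → Member c′ x → Vec.lookup c l ≡ Vec.lookup c′ l
  ChosenVia∧Member⇒≡ _ _ {l} (x∈l , _) (inj₁ σx<H) = ⊥-elim (<-irrefl (∈pair⇒σ≡H l x∈l) σx<H)
  ChosenVia∧Member⇒≡ _ c′ {l} (x∈l , cₗ≡side-x) (inj₂ (l′ , x∈l′ , c′ₗ′≡side-x)) =
    trans cₗ≡side-x (trans (sym c′ₗ′≡side-x) (cong (Vec.lookup c′) (pair-unique l′ l x∈l′ x∈l)))

  family-injective : Injective _≡_ _≡_ family
  family-injective {c} {c′} eq = begin
    c                        ≡⟨ tabulate∘lookup c ⟨
    tabulate (Vec.lookup c)  ≡⟨ tabulate-cong c≗c′ ⟩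
    tabulate (Vec.lookup c′) ≡⟨ tabulate∘lookup c′ ⟩
    c′                       ∎
    where
    open ≡-Reasoning
    c≗c′ : ∀ l → Vec.lookup c l ≡ Vec.lookup c′ l
    c≗c′ l = agree (pair-has-chosen c l)
      where
      agree : ∃[ x ] ChosenVia c l x → Vec.lookup c l ≡ Vec.lookup c′ l
      agree (x , via-l) =
        ChosenVia∧Member⇒≡ c c′ via-l (∈family⁻ c′ (subst (x ∈_) eq (∈family⁺ c (inj₂ (l , via-l)))))

  family-∈-MLCIFs : ∀ c → family c ∈ₗ filter (IsMLCIF? k) (allSubsets N)
  family-∈-MLCIFs c = ∈-filter⁺ (IsMLCIF? k) (∈-allSubsets (family c)) (family-isMLCIF c)

  2^∣P∣≤∣M∣ : 2 ^ ∣P∣ k ≤ ∣M∣ k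
  2^∣P∣≤∣M∣ = begin
    2 ^ m                 ≡⟨ length-allSubsets m ⟨
    length (allSubsets m) ≤⟨ length-≤-injection family (allSubsets-unique m) family-injective
                                                 (λ {c} _ → family-∈-MLCIFs c) ⟩
    ∣M∣ k                 ∎
    where open ≤-Reasoning

lemma4p2 : (k : ℕ) → 1 ≤ k → 2 ∣ k → 2 ^ ∣P∣ k ≤ ∣M∣ k
lemma4p2 zero () _
lemma4p2 k@(suc _) _ k-even = Choices.2^∣P∣≤∣M∣ k k-even Fin.zero
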